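{- Let $m,n,d$ be positive integers with $m\leq 4nd$, $n\leq 4md$, and $d\leq 4mn$. Then $f_d(m,n)\geq\frac{1}{8}\sqrt{m\, n\, d}$.
   Context: For positive integers $m,n,d$, with $[d]=\{1,\dots,d\}$, $$f_d(m,n)=\max_{\substack{A,B\subset(0,\infty)\\|A|\leq m,\ |B|\leq n}}\left\lvert\left\{(a,b)\in A\times B \,\middle|\, \tfrac{a}{b}\in[d]\right\}\right\rvert.$$ -}

module Defs where

open import Data.Nat using (ℕ; suc; _*_)
open import Data.Nat.Properties using (_≟_)
open import Data.List using (List; upTo; length; filter; cartesianProduct)
open import Data.List.Relation.Unary.Any using (Any; any?)
open import Data.Product using (_×_; _,_; proj₁; proj₂)
open import Relation.Binary.PropositionalEquality using (_≡_)
open import Relation.Nullary using (Dec)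

-- a / b ∈ [d] = {1,…,d}  (for b > 0), i.e. a ≡ k * b for some k ∈ {1,…,d}
RatioIn : ℕ → ℕ → ℕ → Set
RatioIn d a b = Any (λ k → a ≡ suc k * b) (upTo d)

ratioIn? : (d a b : ℕ) → Dec (RatioIn d a b)
ratioIn? d a b = any? (λ k → a ≟ suc k * b) (upTo d)

pairCount : ℕ → List ℕ → List ℕ → ℕ
pairCount d A B =
  length (filter (λ p → ratioIn? d (proj₁ p) (proj₂ p)) (cartesianProduct A B))

-- Choose r, t, s with r t ≤ m, r s ≤ n, t s ≤ d and m n d ≤ 64 (r t s)².  Put S = s! and
-- A₀ = {S (k+1) | k < t}, B₀ = {S/(j+1) | j < s}: every a/b with a ∈ A₀, b ∈ B₀ is
-- (k+1)(j+1) ∈ [t s] ⊆ [d].  Take A and B to be the unions of r copies of A₀ and B₀, the i-th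
-- scaled by Q^i with Q larger than all the coefficients, so that the copies are disjoint; then
-- |A| = r t, |B| = r s and there are at least r t s good pairs.
-- If d is the largest of m, n, d, take r = x, t = ⌊m/x⌋, s = ⌊n/x⌋ for the least x with
-- m n ≤ x² d: minimality gives x² d ≤ 4 m n (by d ≤ 4 m n when x = 1), and x ≤ m, n, so
-- m ≤ 2 x t and n ≤ 2 x s; the other cases follow by the cyclic symmetry of the conditions.
module Submission where

open import Defs
open import Data.Nat
open import Data.Nat.Properties
open import Algebra.Properties.CommutativeSemigroup +-commutativeSemigroup
  using () renaming (interchange to +-interchange)
open import Data.Nat.DivMod using (_/_; _%_; m≡m%n+[m/n]*n; m%n<n; m/n≤m; m/n*n≤m; m/n*n≡m; m≥n⇒m/n>0)
open import Data.Nat.Divisibility using (_∣_; ∣-trans; ∣⇒≤; m∣m*n; m≤n⇒m!∣n!)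
open import Data.Nat.Tactic.RingSolver using (solve-∀)
open import Data.List using (List; []; _∷_; _++_; length; filter; map; applyUpTo; cartesianProduct)
open import Data.List.Properties
  using (length-++; filter-++; filter-all; length-applyUpTo; cartesianProductWith-distribʳ-++)
open import Data.List.Relation.Unary.All using (All; []; _∷_)
import Data.List.Relation.Unary.All as All
import Data.List.Relation.Unary.All.Properties as All
open import Data.List.Relation.Unary.Unique.Propositional using (Unique)
import Data.List.Relation.Unary.Unique.Propositional.Properties as Unique
import Data.List.Relation.Unary.AllPairs as AllPairs
open import Data.List.Membership.Propositional using (lose)
open import Data.List.Membership.Propositional.Properties using (∈-upTo⁺)
open import Data.Product using (Σ; ∃-syntax; _×_; _,_; proj₁; proj₂)
open import Data.Bool using (true; false)
open import Data.Sum using (_⊎_; inj₁; inj₂)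
open import Function using (_∘_)
open import Relation.Binary.PropositionalEquality
open import Relation.Nullary using (yes; no; does)
open import Relation.Unary using (Pred; Decidable)

open ≤-Reasoning

length-filter-map : ∀ {a b p} {A : Set a} {B : Set b} {P : Pred B p} (P? : Decidable P)
  (f : A → B) xs → length (filter P? (map f xs)) ≡ length (filter (P? ∘ f) xs)
length-filter-map P? f [] = refl
length-filter-map P? f (x ∷ xs) with does (P? (f x))
... | true = cong suc (length-filter-map P? f xs)
... | false = length-filter-map P? f xs

partners : ℕ → ℕ → List ℕ → ℕ
partners d a B = length (filter (ratioIn? d a) B)

module _ (d : ℕ) where

  private
    ratio? : Decidable (λ (p : ℕ × ℕ) → RatioIn d (proj₁ p) (proj₂ p))
    ratio? p = ratioIn? d (proj₁ p) (proj₂ p)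

  pairCount-∷ : ∀ a A B → pairCount d (a ∷ A) B ≡ partners d a B + pairCount d A B
  pairCount-∷ a A B = begin-equality
    length (filter ratio? (map (a ,_) B ++ cartesianProduct A B))
      ≡⟨ cong length (filter-++ ratio? (map (a ,_) B) _) ⟩
    length (filter ratio? (map (a ,_) B) ++ filter ratio? (cartesianProduct A B))
      ≡⟨ length-++ (filter ratio? (map (a ,_) B)) ⟩
    length (filter ratio? (map (a ,_) B)) + pairCount d A B
      ≡⟨ cong (_+ pairCount d A B) (length-filter-map ratio? (a ,_) B) ⟩
    partners d a B + pairCount d A B ∎

  partners-++ : ∀ a B₁ B₂ → partners d a (B₁ ++ B₂) ≡ partners d a B₁ + partners d a B₂
  partners-++ a B₁ B₂ =
    trans (cong length (filter-++ (ratioIn? d a) B₁ B₂)) (length-++ (filter (ratioIn? d a) B₁))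

  pairCount-++ˡ : ∀ A₁ A₂ B → pairCount d (A₁ ++ A₂) B ≡ pairCount d A₁ B + pairCount d A₂ B
  pairCount-++ˡ A₁ A₂ B = trans
    (cong (length ∘ filter ratio?) (cartesianProductWith-distribʳ-++ _,_ A₁ A₂ B))
    (trans (cong length (filter-++ ratio? (cartesianProduct A₁ B) _))
           (length-++ (filter ratio? (cartesianProduct A₁ B))))

  pairCount-++ʳ : ∀ A B₁ B₂ → pairCount d A (B₁ ++ B₂) ≡ pairCount d A B₁ + pairCount d A B₂
  pairCount-++ʳ [] B₁ B₂ = refl
  pairCount-++ʳ (a ∷ A) B₁ B₂ = begin-equality
    pairCount d (a ∷ A) (B₁ ++ B₂)
      ≡⟨ pairCount-∷ a A (B₁ ++ B₂) ⟩
    partners d a (B₁ ++ B₂) + pairCount d A (B₁ ++ B₂)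
      ≡⟨ cong₂ _+_ (partners-++ a B₁ B₂) (pairCount-++ʳ A B₁ B₂) ⟩
    (partners d a B₁ + partners d a B₂) + (pairCount d A B₁ + pairCount d A B₂)
      ≡⟨ +-interchange (partners d a B₁) _ _ _ ⟩
    (partners d a B₁ + pairCount d A B₁) + (partners d a B₂ + pairCount d A B₂)
      ≡⟨ sym (cong₂ _+_ (pairCount-∷ a A B₁) (pairCount-∷ a A B₂)) ⟩
    pairCount d (a ∷ A) B₁ + pairCount d (a ∷ A) B₂ ∎

  pairCount-++-diagonal : ∀ A₁ A₂ B₁ B₂ →
    pairCount d A₁ B₁ + pairCount d A₂ B₂ ≤ pairCount d (A₁ ++ A₂) (B₁ ++ B₂)
  pairCount-++-diagonal A₁ A₂ B₁ B₂ = begin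
    pairCount d A₁ B₁ + pairCount d A₂ B₂
      ≤⟨ +-mono-≤ (m≤m+n (pairCount d A₁ B₁) _) (m≤n+m (pairCount d A₂ B₂) _) ⟩
    (pairCount d A₁ B₁ + pairCount d A₁ B₂) + (pairCount d A₂ B₁ + pairCount d A₂ B₂)
      ≡⟨ sym (cong₂ _+_ (pairCount-++ʳ A₁ B₁ B₂) (pairCount-++ʳ A₂ B₁ B₂)) ⟩
    pairCount d A₁ (B₁ ++ B₂) + pairCount d A₂ (B₁ ++ B₂)
      ≡⟨ sym (pairCount-++ˡ A₁ A₂ (B₁ ++ B₂)) ⟩
    pairCount d (A₁ ++ A₂) (B₁ ++ B₂) ∎

  pairCount-complete : ∀ A B → All (λ a → All (RatioIn d a) B) A →
    pairCount d A B ≡ length A * length B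
  pairCount-complete [] B [] = refl
  pairCount-complete (a ∷ A) B (aB ∷ AB) = trans (pairCount-∷ a A B)
    (cong₂ _+_ (cong length (filter-all (ratioIn? d a) aB)) (pairCount-complete A B AB))

ratioIn-intro : ∀ {d a b} q → 1 ≤ q → q ≤ d → a ≡ q * b → RatioIn d a b
ratioIn-intro (suc k) _ q≤d a≡qb = lose (∈-upTo⁺ q≤d) a≡qb

layers : (ℕ → List ℕ) → ℕ → List ℕ
layers f zero = []
layers f (suc r) = f r ++ layers f r

module _ (f : ℕ → List ℕ) where

  length-layers : ∀ {ℓ} → (∀ i → length (f i) ≡ ℓ) → ∀ r → length (layers f r) ≡ r * ℓ
  length-layers len zero = refl
  length-layers len (suc r) = trans (length-++ (f r)) (cong₂ _+_ (len r) (length-layers len r))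

  layers⁺ : ∀ {p} {P : Pred ℕ p} → (∀ i → All P (f i)) → ∀ r → All P (layers f r)
  layers⁺ Pf zero = []
  layers⁺ Pf (suc r) = All.++⁺ (Pf r) (layers⁺ Pf r)

  pairCount-layers : ∀ d g {c} → (∀ i → c ≤ pairCount d (f i) (g i)) →
    ∀ r → r * c ≤ pairCount d (layers f r) (layers g r)
  pairCount-layers d g fg zero = z≤n
  pairCount-layers d g fg (suc r) = ≤-trans
    (+-mono-≤ (fg r) (pairCount-layers d g fg r))
    (pairCount-++-diagonal d (f r) (layers f r) (g r) (layers g r))

InLayer : ℕ → ℕ → ℕ → Set
InLayer Q i v = Q ^ i ≤ v × v < Q ^ suc i

inLayer : ∀ Q i {u} → 1 ≤ u → u < Q → InLayer Q i (Q ^ i * u)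
inLayer Q@(suc _) i {u@(suc _)} _ u<Q = m≤m*n (Q ^ i) u , (begin-strict
  Q ^ i * u <⟨ *-monoʳ-< (Q ^ i) {{m^n≢0 Q i}} u<Q ⟩
  Q ^ i * Q ≡⟨ *-comm (Q ^ i) Q ⟩
  Q ^ suc i ∎)

module _ (Q : ℕ) .{{_ : NonZero Q}} (f : ℕ → List ℕ) (inLayer-f : ∀ i → All (InLayer Q i) (f i)) where

  layers-< : ∀ r → All (_< Q ^ r) (layers f r)
  layers-< zero = []
  layers-< (suc r) = All.++⁺ (All.map proj₂ (inLayer-f r))
    (All.map (λ v<Qʳ → <-≤-trans v<Qʳ (m≤n*m (Q ^ r) Q)) (layers-< r))

  layers-unique : (∀ i → Unique (f i)) → ∀ r → Unique (layers f r)
  layers-unique uf zero = AllPairs.[]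
  layers-unique uf (suc r) = Unique.++⁺ (uf r) (layers-unique uf r)
    λ (v∈fr , v∈rest) → ≤⇒≯ (proj₁ (All.lookup (inLayer-f r) v∈fr)) (All.lookup (layers-< r) v∈rest)

  layers-positive : ∀ r → All (0 <_) (layers f r)
  layers-positive = layers⁺ f λ i → All.map (λ v∈i → <-≤-trans (m^n>0 Q i) (proj₁ v∈i)) (inLayer-f i)

suc-∣-! : ∀ {j s} → j < s → suc j ∣ s !
suc-∣-! j<s = ∣-trans (m∣m*n _) (m≤n⇒m!∣n! j<s)

module Copies (t s : ℕ) where

  S Q : ℕ
  S = s !
  Q = suc (S * suc t)

  instance
    S≢0 : NonZero S
    S≢0 = >-nonZero (1≤n! s)

  numerator denominator : ℕ → ℕ → ℕ
  numerator i k = Q ^ i * (S * suc k)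
  denominator i j = Q ^ i * (S / suc j)

  numerators denominators : ℕ → List ℕ
  numerators i = applyUpTo (numerator i) t
  denominators i = applyUpTo (denominator i) s

  S/[1+j]*[1+j]≡S : ∀ {j} → j < s → S / suc j * suc j ≡ S
  S/[1+j]*[1+j]≡S j<s = m/n*n≡m (suc-∣-! j<s)

  1≤S/[1+j] : ∀ {j} → j < s → 1 ≤ S / suc j
  1≤S/[1+j] j<s = m≥n⇒m/n>0 (∣⇒≤ (suc-∣-! j<s))

  S<Q : S < Q
  S<Q = s≤s (m≤m*n S (suc t))

  numerators-inLayer : ∀ i → All (InLayer Q i) (numerators i)
  numerators-inLayer i = All.applyUpTo⁺₁ (numerator i) t λ {k} k<t →
    inLayer Q i (*-mono-≤ (1≤n! s) (s≤s z≤n)) (s≤s (*-monoʳ-≤ S (m≤n⇒m≤1+n k<t)))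

  denominators-inLayer : ∀ i → All (InLayer Q i) (denominators i)
  denominators-inLayer i = All.applyUpTo⁺₁ (denominator i) s λ {j} j<s →
    inLayer Q i (1≤S/[1+j] j<s) (≤-<-trans (m/n≤m S (suc j)) S<Q)

  numerators-unique : ∀ i → Unique (numerators i)
  numerators-unique i = Unique.applyUpTo⁺₁ (numerator i) t λ k<k′ _ eq →
    <⇒≢ k<k′ (suc-injective (*-cancelˡ-≡ _ _ S (*-cancelˡ-≡ _ _ (Q ^ i) {{m^n≢0 Q i}} eq)))

  S/[1+-]-injective : ∀ {j j′} → j < s → j′ < s → S / suc j ≡ S / suc j′ → j ≡ j′
  S/[1+-]-injective {j} {j′} j<s j′<s eq = suc-injective (*-cancelˡ-≡ _ _ (S / suc j)
    {{>-nonZero (1≤S/[1+j] j<s)}} (begin-equality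
      S / suc j * suc j   ≡⟨ S/[1+j]*[1+j]≡S j<s ⟩
      S                   ≡⟨ S/[1+j]*[1+j]≡S j′<s ⟨
      S / suc j′ * suc j′ ≡⟨ cong (_* suc j′) eq ⟨
      S / suc j * suc j′  ∎))

  denominators-unique : ∀ i → Unique (denominators i)
  denominators-unique i = Unique.applyUpTo⁺₁ (denominator i) s λ j<j′ j′<s eq →
    <⇒≢ j<j′ (S/[1+-]-injective (<-trans j<j′ j′<s) j′<s (*-cancelˡ-≡ _ _ (Q ^ i) {{m^n≢0 Q i}} eq))

  numerator≡ : ∀ i {k j} → j < s → numerator i k ≡ suc k * suc j * denominator i j
  numerator≡ i {k} {j} j<s = begin-equality
    Q ^ i * (S * suc k)                           ≡⟨ cong (λ x → Q ^ i * (x * suc k)) (S/[1+j]*[1+j]≡S j<s) ⟨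
    Q ^ i * (S / suc j * suc j * suc k)           ≡⟨ rearrange (Q ^ i) (S / suc j) (suc j) (suc k) ⟩
    suc k * suc j * (Q ^ i * (S / suc j))         ∎
    where
    rearrange : ∀ P W J K → P * (W * J * K) ≡ K * J * (P * W)
    rearrange = solve-∀

  pairCount-copy : ∀ d → t * s ≤ d → ∀ i → pairCount d (numerators i) (denominators i) ≡ t * s
  pairCount-copy d ts≤d i = begin-equality
    pairCount d (numerators i) (denominators i)
      ≡⟨ pairCount-complete d (numerators i) (denominators i) related ⟩
    length (numerators i) * length (denominators i)
      ≡⟨ cong₂ _*_ (length-applyUpTo (numerator i) t) (length-applyUpTo (denominator i) s) ⟩
    t * s ∎
    where
    related : All (λ a → All (RatioIn d a) (denominators i)) (numerators i)
    related = All.applyUpTo⁺₁ (numerator i) t λ k<t → All.applyUpTo⁺₁ (denominator i) s λ j<s →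
      ratioIn-intro _ (s≤s z≤n) (≤-trans (*-mono-≤ k<t j<s) ts≤d) (numerator≡ i j<s)

record Factorisation (m n d : ℕ) : Set where
  constructor factorisation
  field
    r t s : ℕ
    rt≤m : r * t ≤ m
    rs≤n : r * s ≤ n
    ts≤d : t * s ≤ d
    mnd≤64[rts]² : m * n * d ≤ 64 * ((r * t * s) * (r * t * s))

RatioSets : ℕ → ℕ → ℕ → Set
RatioSets m n d = Σ (List ℕ) λ A → Σ (List ℕ) λ B →
  Unique A × Unique B × All (0 <_) A × All (0 <_) B ×
  length A ≤ m × length B ≤ n ×
  m * n * d ≤ 64 * (pairCount d A B * pairCount d A B)

ratioSets : ∀ {m n d} → Factorisation m n d → RatioSets m n d
ratioSets {m} {n} {d} (factorisation r t s rt≤m rs≤n ts≤d mnd≤64[rts]²) =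
  A , B ,
  layers-unique Q numerators numerators-inLayer numerators-unique r ,
  layers-unique Q denominators denominators-inLayer denominators-unique r ,
  layers-positive Q numerators numerators-inLayer r ,
  layers-positive Q denominators denominators-inLayer r ,
  subst (_≤ m) (sym (length-layers numerators (λ i → length-applyUpTo (numerator i) t) r)) rt≤m ,
  subst (_≤ n) (sym (length-layers denominators (λ i → length-applyUpTo (denominator i) s) r)) rs≤n ,
  ≤-trans mnd≤64[rts]² (*-monoʳ-≤ 64 (*-mono-≤ rts≤count rts≤count))
  where
  open Copies t s
  A B : List ℕ
  A = layers numerators r
  B = layers denominators r
  rts≤count : r * t * s ≤ pairCount d A B
  rts≤count = subst (_≤ pairCount d A B) (sym (*-assoc r t s))
    (pairCount-layers numerators d denominators (≤-reflexive ∘ sym ∘ pairCount-copy d ts≤d) r)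

sqrt-bracket-below : ∀ N c k → 0 < N → N ≤ suc k * suc k * c →
  ∃[ p ] p * p * c < N × N ≤ suc p * suc p * c
sqrt-bracket-below N c zero 0<N N≤c = 0 , 0<N , N≤c
sqrt-bracket-below N c (suc k) 0<N N≤[2+k]²c with N ≤? suc k * suc k * c
... | yes N≤[1+k]²c = sqrt-bracket-below N c k 0<N N≤[1+k]²c
... | no N≰[1+k]²c = suc k , ≰⇒> N≰[1+k]²c , N≤[2+k]²c

sqrt-bracket : ∀ N c → 0 < N → 1 ≤ c → ∃[ p ] p * p * c < N × N ≤ suc p * suc p * c
sqrt-bracket N c 0<N 1≤c = sqrt-bracket-below N c N 0<N (begin
  N                         ≤⟨ n≤1+n N ⟩
  suc N                     ≤⟨ m≤m*n (suc N) (suc N) ⟩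
  suc N * suc N             ≤⟨ m≤m*n (suc N * suc N) c {{>-nonZero 1≤c}} ⟩
  suc N * suc N * c         ∎)

<-of-square : ∀ p c u → p * p * c < u * c → p < u
<-of-square p c u p²c<uc = ≤-<-trans (m≤m*m p) (*-cancelʳ-< c (p * p) u p²c<uc)
  where
  m≤m*m : ∀ m → m ≤ m * m
  m≤m*m zero = z≤n
  m≤m*m m@(suc _) = m≤m*n m m

[1+p]²c≤4N : ∀ {N c} p → c ≤ 4 * N → p * p * c < N → suc p * suc p * c ≤ 4 * N
[1+p]²c≤4N zero c≤4N _ = subst (_≤ _) (sym (*-identityˡ _)) c≤4N
[1+p]²c≤4N {N} {c} p@(suc q) _ p²c<N = begin
  suc p * suc p * c   ≤⟨ *-monoˡ-≤ c ([2+q]²≤4[1+q]² q) ⟩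
  4 * (p * p) * c     ≡⟨ *-assoc 4 (p * p) c ⟩
  4 * (p * p * c)     ≤⟨ *-monoʳ-≤ 4 (<⇒≤ p²c<N) ⟩
  4 * N               ∎
  where
  [2+q]²≤4[1+q]² : ∀ q → suc (suc q) * suc (suc q) ≤ 4 * (suc q * suc q)
  [2+q]²≤4[1+q]² q = subst (suc (suc q) * suc (suc q) ≤_) (expand q) (m≤m+n _ (3 * (q * q) + 4 * q))
    where
    expand : ∀ q → suc (suc q) * suc (suc q) + (3 * (q * q) + 4 * q) ≡ 4 * (suc q * suc q)
    expand = solve-∀

m≤2*[m/n]*n : ∀ m n .{{_ : NonZero n}} → n ≤ m → m ≤ 2 * (m / n * n)
m≤2*[m/n]*n m n n≤m = begin
  m                        ≡⟨ m≡m%n+[m/n]*n m n ⟩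
  m % n + m / n * n        ≤⟨ +-monoˡ-≤ (m / n * n) (<⇒≤ (m%n<n m n)) ⟩
  n + m / n * n            ≤⟨ +-monoˡ-≤ (m / n * n) (m≤n*m n (m / n) {{>-nonZero (m≥n⇒m/n>0 n≤m)}}) ⟩
  m / n * n + m / n * n    ≡⟨ cong (m / n * n +_) (+-identityʳ (m / n * n)) ⟨
  2 * (m / n * n)          ∎

volume-bound : ∀ {a b c} x y z .{{_ : NonZero x}} →
  a ≤ 2 * (y * x) → b ≤ 2 * (z * x) → x * x * c ≤ 4 * (a * b) →
  a * b * c ≤ 64 * ((x * y * z) * (x * y * z))
volume-bound {a} {b} {c} x y z a≤2yx b≤2zx x²c≤4ab = *-cancelʳ-≤ _ _ (x * x) {{m*n≢0 x x}} (begin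
  a * b * c * (x * x)               ≡⟨ regroup a b c x ⟩
  (a * b) * (x * x * c)             ≤⟨ *-monoʳ-≤ (a * b) x²c≤4ab ⟩
  (a * b) * (4 * (a * b))           ≤⟨ *-mono-≤ ab≤ (*-monoʳ-≤ 4 ab≤) ⟩
  Y * Z * (4 * (Y * Z))             ≡⟨ expand x y z ⟩
  64 * ((x * y * z) * (x * y * z)) * (x * x) ∎)
  where
  Y Z : ℕ
  Y = 2 * (y * x)
  Z = 2 * (z * x)
  ab≤ : a * b ≤ Y * Z
  ab≤ = *-mono-≤ a≤2yx b≤2zx
  regroup : ∀ a b c x → a * b * c * (x * x) ≡ (a * b) * (x * x * c)
  regroup = solve-∀
  expand : ∀ x y z → 2 * (y * x) * (2 * (z * x)) * (4 * (2 * (y * x) * (2 * (z * x))))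
                     ≡ 64 * ((x * y * z) * (x * y * z)) * (x * x)
  expand = solve-∀

factorise-sorted : ∀ {a b c} → 1 ≤ a → 1 ≤ b → a ≤ c → b ≤ c → c ≤ 4 * a * b → Factorisation a b c
factorise-sorted {a} {b} {c} 1≤a 1≤b a≤c b≤c c≤4ab
  with p , p²c<ab , ab≤x²c ← sqrt-bracket (a * b) c (*-mono-≤ 1≤a 1≤b) (≤-trans 1≤a a≤c) =
  factorisation x y z
    (subst (_≤ a) (*-comm y x) (m/n*n≤m a x))
    (subst (_≤ b) (*-comm z x) (m/n*n≤m b x))
    yz≤c
    (volume-bound x y z (m≤2*[m/n]*n a x x≤a) (m≤2*[m/n]*n b x x≤b)
      ([1+p]²c≤4N p (subst (c ≤_) (*-assoc 4 a b) c≤4ab) p²c<ab))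
  where
  x y z : ℕ
  x = suc p
  y = a / x
  z = b / x
  x≤a : x ≤ a
  x≤a = <-of-square p c a (<-≤-trans p²c<ab (*-monoʳ-≤ a b≤c))
  x≤b : x ≤ b
  x≤b = <-of-square p c b (<-≤-trans p²c<ab (≤-trans (*-monoˡ-≤ b a≤c) (≤-reflexive (*-comm c b))))
  yz≤c : y * z ≤ c
  yz≤c = *-cancelʳ-≤ (y * z) c (x * x) (begin
    y * z * (x * x)       ≡⟨ interleave y z x ⟩
    (y * x) * (z * x)     ≤⟨ *-mono-≤ (m/n*n≤m a x) (m/n*n≤m b x) ⟩
    a * b                 ≤⟨ ab≤x²c ⟩
    x * x * c             ≡⟨ *-comm (x * x) c ⟩
    c * (x * x)           ∎)
    where
    interleave : ∀ y z x → y * z * (x * x) ≡ (y * x) * (z * x)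
    interleave = solve-∀

rotate : ∀ {m n d} → Factorisation m n d → Factorisation n d m
rotate {m} {n} {d} (factorisation r t s rt≤m rs≤n ts≤d mnd≤64[rts]²) =
  factorisation s r t (subst (_≤ n) (*-comm r s) rs≤n) (subst (_≤ d) (*-comm t s) ts≤d) rt≤m
    (subst₂ (λ u v → u ≤ 64 * (v * v)) (rotate₃ m n d) (sym (rotate₃ s r t)) mnd≤64[rts]²)
  where
  rotate₃ : ∀ a b c → a * b * c ≡ b * c * a
  rotate₃ = solve-∀

factorise : ∀ {m n d} → 1 ≤ m → 1 ≤ n → 1 ≤ d →
  m ≤ 4 * n * d → n ≤ 4 * m * d → d ≤ 4 * m * n → Factorisation m n d
factorise {m} {n} {d} 1≤m 1≤n 1≤d m≤4nd n≤4md d≤4mn =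
  by-order (≤-total m d) (≤-total n d) (≤-total m n)
  where
  m-largest : n ≤ m → d ≤ m → Factorisation m n d
  m-largest n≤m d≤m = rotate (rotate (factorise-sorted 1≤n 1≤d n≤m d≤m m≤4nd))
  n-largest : m ≤ n → d ≤ n → Factorisation m n d
  n-largest m≤n d≤n = rotate (factorise-sorted 1≤d 1≤m d≤n m≤n (subst (n ≤_) (swap-4ab m d) n≤4md))
    where
    swap-4ab : ∀ a b → 4 * a * b ≡ 4 * b * a
    swap-4ab = solve-∀
  by-order : m ≤ d ⊎ d ≤ m → n ≤ d ⊎ d ≤ n → m ≤ n ⊎ n ≤ m → Factorisation m n d
  by-order (inj₁ m≤d) (inj₁ n≤d) _          = factorise-sorted 1≤m 1≤n m≤d n≤d d≤4mn
  by-order _          (inj₂ d≤n) (inj₁ m≤n) = n-largest m≤n d≤n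
  by-order (inj₂ d≤m) _          (inj₂ n≤m) = m-largest n≤m d≤m
  by-order (inj₁ m≤d) (inj₂ d≤n) (inj₂ _)   = n-largest (≤-trans m≤d d≤n) d≤n
  by-order (inj₂ d≤m) (inj₁ n≤d) (inj₁ _)   = m-largest (≤-trans n≤d d≤m) d≤m

proposition3 : (m n d : ℕ) → 1 ≤ m → 1 ≤ n → 1 ≤ d →
    m ≤ 4 * n * d → n ≤ 4 * m * d → d ≤ 4 * m * n →
    Σ (List ℕ) λ A → Σ (List ℕ) λ B →
    Unique A × Unique B × All (0 <_) A × All (0 <_) B ×
    length A ≤ m × length B ≤ n ×
    m * n * d ≤ 64 * (pairCount d A B * pairCount d A B)
proposition3 m n d 1≤m 1≤n 1≤d m≤4nd n≤4md d≤4mn =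
  ratioSets (factorise 1≤m 1≤n 1≤d m≤4nd n≤4md d≤4mn)
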